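{- If $G$ is a graph, then $\mathrm{gp}(G)\le \mathrm{gp}(D(G))\le 2\,\mathrm{gp}(G)$, and both bounds are sharp (i.e., each is attained with equality by some graph). Moreover, $\mathrm{gp}(D(G))=2\,\mathrm{gp}(G)$ if and only if the gp-sets of $D(G)$ are of the form $X\cup X'$, where $X$ is an independent gp-set of $G$ and $X'=\{u': u\in X\}$.
   Context: All graphs are finite and simple. The double graph $D(G)$ is obtained from the disjoint union of $G$ and a copy $G'$ with $V(G')=\{u': u\in V(G)\}$ by joining each $u\in V(G)$ to all neighbors of $u'$ in $G'$ and each $u'$ to all neighbors of $u$ in $G$. A set of vertices is a general position set if no three of its vertices lie on a common shortest path; $\mathrm{gp}(H)$ is the maximum size of a general position set of $H$, and a general position set of that maximum size is called a gp-set. -}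

module Defs where

open import Data.Nat using (ℕ; zero; suc; _+_; _*_; _≤_)
open import Data.Fin using (Fin; splitAt)
open import Data.Fin.Subset using (Subset; _∈_; ∣_∣)
open import Data.Bool using (Bool; true; false; T)
open import Data.Sum using (_⊎_; [_,_]′)
open import Data.Product using (Σ; ∃; _×_; _,_)
open import Data.Vec using (_++_)
open import Relation.Binary.PropositionalEquality using (_≡_; _≢_; refl)
open import Relation.Nullary using (¬_)
open import Function using (id; _∘_)

record Graph (n : ℕ) : Set where
  field
    adj    : Fin n → Fin n → Bool
    sym    : ∀ u v → adj u v ≡ adj v u
    irrefl : ∀ u → adj u u ≡ false
open Graph public

module _ {n : ℕ} (G : Graph n) where

  data Walk : Fin n → Fin n → Set where
    [_]  : ∀ u → Walk u u
    step : ∀ u {v w} → T (adj G u v) → Walk v w → Walk u w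

  len : ∀ {u v} → Walk u v → ℕ
  len [ u ]        = 0
  len (step u _ p) = suc (len p)

  OnWalk : ∀ {u v} → Fin n → Walk u v → Set
  OnWalk x [ u ]        = x ≡ u
  OnWalk x (step u _ p) = x ≡ u ⊎ OnWalk x p

  IsShortest : ∀ {u v} → Walk u v → Set
  IsShortest {u} {v} p = ∀ (q : Walk u v) → len p ≤ len q

  OnCommonGeodesic : Fin n → Fin n → Fin n → Set
  OnCommonGeodesic x y z =
    Σ (Fin n) λ u → Σ (Fin n) λ v → Σ (Walk u v) λ p →
      IsShortest p × OnWalk x p × OnWalk y p × OnWalk z p

  GenPos : Subset n → Set
  GenPos S = ∀ x y z → x ∈ S → y ∈ S → z ∈ S →
             x ≢ y → y ≢ z → x ≢ z → ¬ OnCommonGeodesic x y z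

  IsGPSet : Subset n → Set
  IsGPSet S = GenPos S × (∀ T → GenPos T → ∣ T ∣ ≤ ∣ S ∣)

  IsGP : ℕ → Set
  IsGP k = (Σ (Subset n) λ S → GenPos S × ∣ S ∣ ≡ k)
         × (∀ S → GenPos S → ∣ S ∣ ≤ k)

  Independent : Subset n → Set
  Independent X = ∀ u v → u ∈ X → v ∈ X → adj G u v ≡ false

-- Double graph. Vertices of D(G) are Fin (n + n); the vertex u of G is
-- Fin.inject+ n u (first block) and its copy u' is Fin.raise n u
-- (second block). proj sends both u and u' to u.
proj : ∀ {n} → Fin (n + n) → Fin n
proj {n} = [ id , id ]′ ∘ splitAt n

D : ∀ {n} → Graph n → Graph (n + n)
D G = record
  { adj    = λ x y → adj G (proj x) (proj y)
  ; sym    = λ x y → sym G (proj x) (proj y)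
  ; irrefl = λ x → irrefl G (proj x)
  }

-- For X ⊆ V(G), the subset X ∪ X' of V(D(G)).
doubleSet : ∀ {n} → Subset n → Subset (n + n)
doubleSet X = X ++ X

{-# OPTIONS --safe #-}
module Submission where

open import Defs renaming (sym to adj-sym)
open import Data.Nat using (ℕ; suc; _+_; _*_; _≤_; _<_; z≤n; s≤s)
open import Data.Nat.Properties
  using ( ≤-antisym; ≤-refl; ≤-trans; +-cancelʳ-≤; +-monoʳ-≤; +-mono-≤; +-comm; +-identityʳ
        ; ≤⇒≯; ≤ᵇ⇒≤; module ≤-Reasoning)
open import Data.Fin using (Fin; zero; suc; #_; toℕ; _↑ˡ_; _↑ʳ_; splitAt)
open import Data.Fin.Properties using (_≟_; splitAt-↑ˡ; splitAt-↑ʳ; toℕ<n; toℕ-injective)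
open import Data.Fin.Subset using (Subset; _∈_; _⊆_; _∪_; ∣_∣; ⊤; inside; outside) renaming (⊥ to ∅)
open import Data.Fin.Subset.Properties
  using (_∈?_; ∉⊥; ∣⊥∣≡0; ∣⊤∣≡n; ∣p∣≤n; drop-∷-⊆; p⊆q⇒∣p∣≤∣q∣; p⊆p∪q; q⊆p∪q; x∈p∪q⁻)
open import Data.Vec using ([]; _∷_; _++_; here; there)
import Data.Vec as Vec
open import Data.Bool using (true; false; not; T)
open import Data.Unit using (tt)
open import Data.Empty using (⊥; ⊥-elim)
open import Data.Sum using (_⊎_; inj₁; inj₂; [_,_]′)
open import Data.Product using (Σ; _×_; _,_; proj₁; proj₂)
open import Function using (id; _∘_; flip)
open import Function.Bundles using (_⇔_; mk⇔)
open import Relation.Binary.PropositionalEquality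
  using (_≡_; _≢_; refl; sym; trans; cong; cong₂; subst; module ≡-Reasoning)
open import Relation.Nullary using (¬_; yes; no; does; contradiction)

-- Adjacency in D(G) depends only on the projection u, u′ ↦ u, so walks of D(G) project to
-- walks of G of the same length and every section of the projection lifts walks of G back.
-- Hence a geodesic of D(G) between non-twins projects to a geodesic of G, while a geodesic
-- between twins has length at most 2 and meets at most two twin classes; so a general position
-- set of G placed in one layer stays in general position in D(G). Conversely, if L ∪ R′ is in
-- general position in D(G), lifting along sections shows that L, R and L ∪ R are in general
-- position in G. If |L| + |R| = 2 gp(G), then |L ∪ R| ≤ gp(G) forces L = R, and L is independent
-- because for an edge uv the path u v u′ is a geodesic. K₁ and K₂ (D(K₂) = C₄) attain the bounds.

adj-subst : ∀ {n} (G : Graph n) {u u′ v v′} →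
            u ≡ u′ → v ≡ v′ → T (adj G u v) → T (adj G u′ v′)
adj-subst G refl refl e = e

adjacent⇒≢ : ∀ {n} (G : Graph n) {u v} → T (adj G u v) → u ≢ v
adjacent⇒≢ G {u} e refl = subst T (irrefl G u) e

IsHomomorphism : ∀ {m n} → Graph m → Graph n → (Fin m → Fin n) → Set
IsHomomorphism H K f = ∀ {x y} → T (adj H x y) → T (adj K (f x) (f y))

module _ {m n} {H : Graph m} {K : Graph n} {f : Fin m → Fin n} (f-hom : IsHomomorphism H K f) where

  mapWalk : ∀ {a b} → Walk H a b → Walk K (f a) (f b)
  mapWalk [ a ]        = [ f a ]
  mapWalk (step a e p) = step (f a) (f-hom e) (mapWalk p)

  len-mapWalk : ∀ {a b} (p : Walk H a b) → len K (mapWalk p) ≡ len H p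
  len-mapWalk [ a ]        = refl
  len-mapWalk (step a e p) = cong suc (len-mapWalk p)

  OnWalk-mapWalk : ∀ {a b x} (p : Walk H a b) → OnWalk H x p → OnWalk K (f x) (mapWalk p)
  OnWalk-mapWalk [ a ]        x≡a        = cong f x≡a
  OnWalk-mapWalk (step a e p) (inj₁ x≡a) = inj₁ (cong f x≡a)
  OnWalk-mapWalk (step a e p) (inj₂ x∈p) = inj₂ (OnWalk-mapWalk p x∈p)

castWalk : ∀ {n} {G : Graph n} {a a′ b b′} → a ≡ a′ → b ≡ b′ → Walk G a b → Walk G a′ b′
castWalk refl refl p = p

len-castWalk : ∀ {n} {G : Graph n} {a a′ b b′} (a≡a′ : a ≡ a′) (b≡b′ : b ≡ b′)
               (p : Walk G a b) → len G (castWalk a≡a′ b≡b′ p) ≡ len G p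
len-castWalk refl refl p = refl

module _ {m n} {H : Graph m} {K : Graph n} {φ : Fin m → Fin n} {ψ : Fin n → Fin m}
         (φ-hom : IsHomomorphism H K φ) (ψ-hom : IsHomomorphism K H ψ) where

  mapWalk-shortest : ∀ {a b} → ψ (φ a) ≡ a → ψ (φ b) ≡ b →
                     (p : Walk H a b) → IsShortest H p → IsShortest K (mapWalk φ-hom p)
  mapWalk-shortest {a} {b} a-fixed b-fixed p p-shortest q = begin
    len K (mapWalk φ-hom p) ≡⟨ len-mapWalk φ-hom p ⟩
    len H p                 ≤⟨ p-shortest q′ ⟩
    len H q′                ≡⟨ len-castWalk a-fixed b-fixed (mapWalk ψ-hom q) ⟩
    len H (mapWalk ψ-hom q) ≡⟨ len-mapWalk ψ-hom q ⟩
    len K q                 ∎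
    where
    open ≤-Reasoning
    q′ : Walk H a b
    q′ = castWalk a-fixed b-fixed (mapWalk ψ-hom q)

  module _ (ψ∘φ≗id : ∀ x → ψ (φ x) ≡ x) where

    mapGeodesic : ∀ {x y z} → OnCommonGeodesic H x y z → OnCommonGeodesic K (φ x) (φ y) (φ z)
    mapGeodesic (a , b , p , p-shortest , x∈p , y∈p , z∈p) =
      φ a , φ b , mapWalk φ-hom p , mapWalk-shortest (ψ∘φ≗id a) (ψ∘φ≗id b) p p-shortest ,
      OnWalk-mapWalk φ-hom p x∈p , OnWalk-mapWalk φ-hom p y∈p , OnWalk-mapWalk φ-hom p z∈p

    GenPos-pullback : ∀ {S X} → (∀ {w} → w ∈ X → φ w ∈ S) → GenPos K S → GenPos H X
    GenPos-pullback X⊆φ⁻¹S S-gp x y z x∈X y∈X z∈X x≢y y≢z x≢z geodesic =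
      S-gp (φ x) (φ y) (φ z) (X⊆φ⁻¹S x∈X) (X⊆φ⁻¹S y∈X) (X⊆φ⁻¹S z∈X)
           (x≢y ∘ φ-injective) (y≢z ∘ φ-injective) (x≢z ∘ φ-injective)
           (mapGeodesic geodesic)
      where
      φ-injective : ∀ {u v} → φ u ≡ φ v → u ≡ v
      φ-injective {u} {v} φu≡φv =
        trans (sym (ψ∘φ≗id u)) (trans (cong ψ φu≡φv) (ψ∘φ≗id v))

nonadjacent⇒2≤len : ∀ {n} (G : Graph n) {a c} (q : Walk G a c) →
                    a ≢ c → ¬ T (adj G a c) → 2 ≤ len G q
nonadjacent⇒2≤len G [ a ]                     a≢a _    = contradiction refl a≢a
nonadjacent⇒2≤len G (step a a~c [ c ])        _   ¬a~c = contradiction a~c ¬a~c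
nonadjacent⇒2≤len G (step a _ (step v _ _))   _   _    = s≤s (s≤s z≤n)

P₃-geodesic : ∀ {n} (G : Graph n) {a b c} →
              T (adj G a b) → T (adj G b c) → a ≢ c → ¬ T (adj G a c) → OnCommonGeodesic G a b c
P₃-geodesic G {a} {b} {c} a~b b~c a≢c ¬a~c =
  a , c , step a a~b (step b b~c [ c ]) , (λ q → nonadjacent⇒2≤len G q a≢c ¬a~c) ,
  inj₁ refl , inj₂ (inj₁ refl) , inj₂ (inj₂ refl)

pigeonhole₂ : ∀ {A : Set} {s t x y z : A} →
              x ≡ s ⊎ x ≡ t → y ≡ s ⊎ y ≡ t → z ≡ s ⊎ z ≡ t → x ≢ y → y ≢ z → x ≢ z → ⊥
pigeonhole₂ (inj₁ refl) (inj₁ refl) _           x≢y _   _   = x≢y refl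
pigeonhole₂ (inj₂ refl) (inj₂ refl) _           x≢y _   _   = x≢y refl
pigeonhole₂ (inj₁ refl) (inj₂ refl) (inj₁ refl) _   _   x≢z = x≢z refl
pigeonhole₂ (inj₁ refl) (inj₂ refl) (inj₂ refl) _   y≢z _   = y≢z refl
pigeonhole₂ (inj₂ refl) (inj₁ refl) (inj₁ refl) _   y≢z _   = y≢z refl
pigeonhole₂ (inj₂ refl) (inj₁ refl) (inj₂ refl) _   _   x≢z = x≢z refl

∣++∣ : ∀ {m k} (L : Subset m) (R : Subset k) → ∣ L ++ R ∣ ≡ ∣ L ∣ + ∣ R ∣
∣++∣ []            R = refl
∣++∣ (inside ∷ L)  R = cong suc (∣++∣ L R)
∣++∣ (outside ∷ L) R = ∣++∣ L R

∈-++⁺ˡ : ∀ {m k} {L : Subset m} {R : Subset k} {u} → u ∈ L → u ↑ˡ k ∈ L ++ R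
∈-++⁺ˡ here        = here
∈-++⁺ˡ (there u∈L) = there (∈-++⁺ˡ u∈L)

∈-++⁺ʳ : ∀ {m k} (L : Subset m) {R : Subset k} {u} → u ∈ R → m ↑ʳ u ∈ L ++ R
∈-++⁺ʳ []      u∈R = u∈R
∈-++⁺ʳ (_ ∷ L) u∈R = there (∈-++⁺ʳ L u∈R)

∈-++∅⁻ : ∀ {m k} (X : Subset m) {x} → x ∈ X ++ ∅ {k} →
         Σ (Fin m) λ u → x ≡ u ↑ˡ k × u ∈ X
∈-++∅⁻ []      x∈∅         = contradiction x∈∅ ∉⊥
∈-++∅⁻ (_ ∷ X) here        = zero , refl , here
∈-++∅⁻ (_ ∷ X) (there x∈X) with ∈-++∅⁻ X x∈X
... | u , refl , u∈X = suc u , refl , there u∈X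

p⊆q∧∣q∣≤∣p∣⇒p≡q : ∀ {n} {p q : Subset n} → p ⊆ q → ∣ q ∣ ≤ ∣ p ∣ → p ≡ q
p⊆q∧∣q∣≤∣p∣⇒p≡q {p = []}          {[]}          _   _ = refl
p⊆q∧∣q∣≤∣p∣⇒p≡q {p = outside ∷ p} {outside ∷ q} p⊆q ∣q∣≤∣p∣ =
  cong (outside ∷_) (p⊆q∧∣q∣≤∣p∣⇒p≡q (drop-∷-⊆ p⊆q) ∣q∣≤∣p∣)
p⊆q∧∣q∣≤∣p∣⇒p≡q {p = inside ∷ p}  {inside ∷ q}  p⊆q (s≤s ∣q∣≤∣p∣) =
  cong (inside ∷_) (p⊆q∧∣q∣≤∣p∣⇒p≡q (drop-∷-⊆ p⊆q) ∣q∣≤∣p∣)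
p⊆q∧∣q∣≤∣p∣⇒p≡q {p = inside ∷ p}  {outside ∷ q} p⊆q _ =
  contradiction (p⊆q here) λ ()
p⊆q∧∣q∣≤∣p∣⇒p≡q {p = outside ∷ p} {inside ∷ q}  p⊆q ∣q∣<∣p∣ =
  contradiction ∣q∣<∣p∣ (≤⇒≯ (p⊆q⇒∣p∣≤∣q∣ (drop-∷-⊆ p⊆q)))

∣p∪q∣≤∣p∣∧∣p∪q∣≤∣q∣⇒p≡q : ∀ {n} (p q : Subset n) →
                          ∣ p ∪ q ∣ ≤ ∣ p ∣ → ∣ p ∪ q ∣ ≤ ∣ q ∣ → p ≡ q
∣p∪q∣≤∣p∣∧∣p∪q∣≤∣q∣⇒p≡q p q ∣p∪q∣≤∣p∣ ∣p∪q∣≤∣q∣ =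
  trans (p⊆q∧∣q∣≤∣p∣⇒p≡q (p⊆p∪q q) ∣p∪q∣≤∣p∣)
        (sym (p⊆q∧∣q∣≤∣p∣⇒p≡q (q⊆p∪q p q) ∣p∪q∣≤∣q∣))

m≤k∧n≤k∧m+n≡k+k⇒m≡k : ∀ {m n k} → m ≤ k → n ≤ k → m + n ≡ k + k → m ≡ k
m≤k∧n≤k∧m+n≡k+k⇒m≡k {m} {n} {k} m≤k n≤k m+n≡k+k = ≤-antisym m≤k (+-cancelʳ-≤ k k m k+k≤m+k)
  where
  open ≤-Reasoning
  k+k≤m+k : k + k ≤ m + k
  k+k≤m+k = begin
    k + k ≡⟨ m+n≡k+k ⟨
    m + n ≤⟨ +-monoʳ-≤ m n≤k ⟩
    m + k ∎

k+k≡2*k : ∀ k → k + k ≡ 2 * k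
k+k≡2*k k = cong (k +_) (sym (+-identityʳ k))

proj-↑ˡ : ∀ {n} (u : Fin n) → proj (u ↑ˡ n) ≡ u
proj-↑ˡ {n} u = cong [ id , id ]′ (splitAt-↑ˡ n u n)

proj-↑ʳ : ∀ {n} (u : Fin n) → proj (n ↑ʳ u) ≡ u
proj-↑ʳ {n} u = cong [ id , id ]′ (splitAt-↑ʳ n n u)

↑ˡ≢↑ʳ : ∀ {m n} (u : Fin m) (v : Fin n) → u ↑ˡ n ≢ m ↑ʳ v
↑ˡ≢↑ʳ {m} {n} u v u≡v
  with () ← trans (sym (splitAt-↑ˡ m u n)) (trans (cong (splitAt m) u≡v) (splitAt-↑ʳ m n v))

IsSection : ∀ {n} → (Fin n → Fin (n + n)) → Set
IsSection c = ∀ u → proj (c u) ≡ u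

section-through : ∀ {n} (a b : Fin (n + n)) → proj a ≢ proj b →
                  Σ (Fin n → Fin (n + n)) λ c → IsSection c × c (proj a) ≡ a × c (proj b) ≡ b
section-through {n} a b pa≢pb = c , c-section , c-a (proj a) refl , c-b (proj b) refl
  where
  c : Fin n → Fin (n + n)
  c u with u ≟ proj a | u ≟ proj b
  ... | yes _ | _     = a
  ... | no _  | yes _ = b
  ... | no _  | no _  = u ↑ˡ n

  c-section : IsSection c
  c-section u with u ≟ proj a | u ≟ proj b
  ... | yes u≡pa | _        = sym u≡pa
  ... | no _     | yes u≡pb = sym u≡pb
  ... | no _     | no _     = proj-↑ˡ u

  c-a : ∀ u → u ≡ proj a → c u ≡ a
  c-a u u≡pa with u ≟ proj a
  ... | yes _    = refl
  ... | no u≢pa = contradiction u≡pa u≢pa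

  c-b : ∀ u → u ≡ proj b → c u ≡ b
  c-b u u≡pb with u ≟ proj a | u ≟ proj b
  ... | yes u≡pa | _       = contradiction (trans (sym u≡pa) u≡pb) pa≢pb
  ... | no _     | yes _   = refl
  ... | no _     | no u≢pb = contradiction u≡pb u≢pb

module _ {n} (G : Graph n) where

  proj-hom : IsHomomorphism (D G) G proj
  proj-hom e = e

  section-hom : ∀ {c} → IsSection c → IsHomomorphism G (D G) c
  section-hom c-section {u} {v} = adj-subst G (sym (c-section u)) (sym (c-section v))

  GenPos-section : ∀ {c} {S : Subset (n + n)} {X : Subset n} → IsSection c →
                   (∀ {u} → u ∈ X → c u ∈ S) → GenPos (D G) S → GenPos G X
  GenPos-section c-section = GenPos-pullback (section-hom c-section) proj-hom c-section

  GenPos-++ˡ : ∀ L R → GenPos (D G) (L ++ R) → GenPos G L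
  GenPos-++ˡ L R = GenPos-section proj-↑ˡ ∈-++⁺ˡ

  GenPos-++ʳ : ∀ L R → GenPos (D G) (L ++ R) → GenPos G R
  GenPos-++ʳ L R = GenPos-section proj-↑ʳ (∈-++⁺ʳ L)

  GenPos-∪ : ∀ L R → GenPos (D G) (L ++ R) → GenPos G (L ∪ R)
  GenPos-∪ L R = GenPos-section c-section c-∈
    where
    c : Fin n → Fin (n + n)
    c u with u ∈? L
    ... | yes _ = u ↑ˡ n
    ... | no _  = n ↑ʳ u

    c-section : IsSection c
    c-section u with u ∈? L
    ... | yes _ = proj-↑ˡ u
    ... | no _  = proj-↑ʳ u

    c-∈ : ∀ {u} → u ∈ L ∪ R → c u ∈ L ++ R
    c-∈ {u} u∈L∪R with u ∈? L
    ... | yes u∈L = ∈-++⁺ˡ u∈L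
    ... | no u∉L  = ∈-++⁺ʳ L ([ flip contradiction u∉L , id ]′ (x∈p∪q⁻ L R u∈L∪R))

  twins-geodesic-meets-two-classes :
    ∀ {a b} (p : Walk (D G) a b) → IsShortest (D G) p → proj {n} a ≡ proj b →
    Σ (Fin n) λ s → Σ (Fin n) λ t → ∀ {x} → OnWalk (D G) x p → proj x ≡ s ⊎ proj x ≡ t
  twins-geodesic-meets-two-classes [ a ] _ _ = proj a , proj a , inj₁ ∘ cong proj
  twins-geodesic-meets-two-classes (step a a~b [ b ]) _ pa≡pb =
    contradiction pa≡pb (adjacent⇒≢ G a~b)
  twins-geodesic-meets-two-classes (step a a~v (step v v~b [ b ])) _ pa≡pb = proj a , proj v , classes
    where
    classes : ∀ {x} → OnWalk (D G) x (step a a~v (step v v~b [ b ])) →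
              proj x ≡ proj a ⊎ proj x ≡ proj v
    classes (inj₁ refl)        = inj₁ refl
    classes (inj₂ (inj₁ refl)) = inj₂ refl
    classes (inj₂ (inj₂ refl)) = inj₁ (sym pa≡pb)
  twins-geodesic-meets-two-classes {b = b} (step a a~v (step v _ (step _ _ _))) p-shortest pa≡pb =
    contradiction (p-shortest (step a a~v (step v v~b [ b ]))) λ { (s≤s (s≤s ())) }
    where
    v~b : T (adj (D G) v b)
    v~b = adj-subst G refl pa≡pb (subst T (adj-sym G (proj {n} a) (proj v)) a~v)

  geodesic-projects : ∀ {x y z} → OnCommonGeodesic (D G) x y z →
                      proj x ≢ proj y → proj y ≢ proj z → proj x ≢ proj z →
                      OnCommonGeodesic G (proj x) (proj y) (proj z)
  geodesic-projects (a , b , p , p-shortest , x∈p , y∈p , z∈p) _ _ _ with proj a ≟ proj b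
  ... | no pa≢pb with section-through {n} a b pa≢pb
  ...   | c , c-section , c-a , c-b =
    proj a , proj b , mapWalk proj-hom p ,
    mapWalk-shortest proj-hom (section-hom c-section) c-a c-b p p-shortest ,
    OnWalk-mapWalk proj-hom p x∈p , OnWalk-mapWalk proj-hom p y∈p , OnWalk-mapWalk proj-hom p z∈p
  geodesic-projects (_ , _ , p , p-shortest , x∈p , y∈p , z∈p) px≢py py≢pz px≢pz
    | yes pa≡pb with twins-geodesic-meets-two-classes p p-shortest pa≡pb
  ...   | _ , _ , classes =
    ⊥-elim (pigeonhole₂ (classes x∈p) (classes y∈p) (classes z∈p) px≢py py≢pz px≢pz)

  GenPos-twinFree : ∀ {S : Subset (n + n)} {X : Subset n} →
                    (∀ {x} → x ∈ S → proj x ∈ X) →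
                    (∀ {x y} → x ∈ S → y ∈ S → proj x ≡ proj y → x ≡ y) →
                    GenPos G X → GenPos (D G) S
  GenPos-twinFree S→X twinFree X-gp x y z x∈S y∈S z∈S x≢y y≢z x≢z geodesic =
    X-gp _ _ _ (S→X x∈S) (S→X y∈S) (S→X z∈S) px≢py py≢pz px≢pz
         (geodesic-projects geodesic px≢py py≢pz px≢pz)
    where
    px≢py : proj x ≢ proj y
    px≢py = x≢y ∘ twinFree x∈S y∈S
    py≢pz : proj y ≢ proj z
    py≢pz = y≢z ∘ twinFree y∈S z∈S
    px≢pz : proj x ≢ proj z
    px≢pz = x≢z ∘ twinFree x∈S z∈S

  GenPos-++∅ : ∀ {X} → GenPos G X → GenPos (D G) (X ++ ∅)
  GenPos-++∅ {X} = GenPos-twinFree proj∈X twinFree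
    where
    proj∈X : ∀ {x} → x ∈ X ++ ∅ → proj x ∈ X
    proj∈X x∈X++∅ with ∈-++∅⁻ X x∈X++∅
    ... | u , refl , u∈X = subst (_∈ X) (sym (proj-↑ˡ u)) u∈X

    twinFree : ∀ {x y} → x ∈ X ++ ∅ → y ∈ X ++ ∅ → proj x ≡ proj y → x ≡ y
    twinFree x∈X++∅ y∈X++∅ px≡py with ∈-++∅⁻ X x∈X++∅ | ∈-++∅⁻ X y∈X++∅
    ... | u , refl , _ | v , refl , _ =
      cong (_↑ˡ n) (trans (sym (proj-↑ˡ u)) (trans px≡py (proj-↑ˡ v)))

  twins-neighbour-geodesic : ∀ {u x} → T (adj G u (proj x)) →
                             OnCommonGeodesic (D G) (u ↑ˡ n) x (n ↑ʳ u)
  twins-neighbour-geodesic {u} {x} u~x = P₃-geodesic (D G) u~x′ x~u′ (↑ˡ≢↑ʳ u u) ¬u~u′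
    where
    u~x′ : T (adj (D G) (u ↑ˡ n) x)
    u~x′ = adj-subst G (sym (proj-↑ˡ u)) refl u~x
    x~u′ : T (adj (D G) x (n ↑ʳ u))
    x~u′ = adj-subst G refl (sym (proj-↑ʳ u)) (subst T (adj-sym G u (proj x)) u~x)
    ¬u~u′ : ¬ T (adj (D G) (u ↑ˡ n) (n ↑ʳ u))
    ¬u~u′ u~u′ = adjacent⇒≢ G u~u′ (trans (proj-↑ˡ u) (sym (proj-↑ʳ u)))

  GenPos⇒¬twins+neighbour : ∀ {S u x} → GenPos (D G) S →
                            u ↑ˡ n ∈ S → n ↑ʳ u ∈ S → x ∈ S → ¬ T (adj G u (proj x))
  GenPos⇒¬twins+neighbour {u = u} {x} S-gp u∈S u′∈S x∈S u~x =
    S-gp _ _ _ u∈S x∈S u′∈S u≢x x≢u′ (↑ˡ≢↑ʳ u u) (twins-neighbour-geodesic u~x)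
    where
    u≢x : u ↑ˡ n ≢ x
    u≢x u≡x = adjacent⇒≢ G u~x (trans (sym (proj-↑ˡ u)) (cong proj u≡x))
    x≢u′ : x ≢ n ↑ʳ u
    x≢u′ x≡u′ = adjacent⇒≢ G u~x (sym (trans (cong proj x≡u′) (proj-↑ʳ u)))

  GenPos-++-independent : ∀ {X} → GenPos (D G) (X ++ X) → Independent G X
  GenPos-++-independent {X} X++X-gp u v u∈X v∈X with adj G u v in u~v
  ... | false = refl
  ... | true  = contradiction (adj-subst G refl (sym (proj-↑ˡ v)) (subst T (sym u~v) tt))
                  (GenPos⇒¬twins+neighbour X++X-gp
                     (∈-++⁺ˡ u∈X) (∈-++⁺ʳ X u∈X) (∈-++⁺ˡ v∈X))

module _ {n} {G : Graph n} {k} (gp-G : IsGP G k) where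

  GenPos∧∣∣≡gp⇒IsGPSet : ∀ {X} → GenPos G X → ∣ X ∣ ≡ k → IsGPSet G X
  GenPos∧∣∣≡gp⇒IsGPSet X-gp ∣X∣≡k =
    X-gp , λ S S-gp → subst (∣ S ∣ ≤_) (sym ∣X∣≡k) (proj₂ gp-G S S-gp)

  gpSet : Σ (Subset n) (IsGPSet G)
  gpSet with proj₁ gp-G
  ... | X , X-gp , ∣X∣≡k = X , GenPos∧∣∣≡gp⇒IsGPSet X-gp ∣X∣≡k

  IsGPSet⇒∣∣≡gp : ∀ {X} → IsGPSet G X → ∣ X ∣ ≡ k
  IsGPSet⇒∣∣≡gp (X-gp , X-max) with proj₁ gp-G
  ... | Y , Y-gp , ∣Y∣≡k =
    ≤-antisym (proj₂ gp-G _ X-gp) (subst (_≤ _) ∣Y∣≡k (X-max Y Y-gp))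

IsDoubledGPSet : ∀ {n} → Graph n → Subset (n + n) → Set
IsDoubledGPSet {n} G S = Σ (Subset n) λ X → Independent G X × IsGPSet G X × S ≡ doubleSet X

module _ {n} {G : Graph n} {k k′} (gp-G : IsGP G k) (gp-DG : IsGP (D G) k′) where

  gp≤gp-D : k ≤ k′
  gp≤gp-D with proj₁ gp-G
  ... | X , X-gp , ∣X∣≡k = begin
    k                 ≡⟨ ∣X∣≡k ⟨
    ∣ X ∣             ≡⟨ +-identityʳ ∣ X ∣ ⟨
    ∣ X ∣ + 0         ≡⟨ cong (∣ X ∣ +_) (∣⊥∣≡0 n) ⟨
    ∣ X ∣ + ∣ ∅ {n} ∣ ≡⟨ ∣++∣ X ∅ ⟨
    ∣ X ++ ∅ ∣        ≤⟨ proj₂ gp-DG (X ++ ∅) (GenPos-++∅ G X-gp) ⟩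
    k′                ∎
    where open ≤-Reasoning

  ∣GenPos-D∣≤2gp : ∀ S → GenPos (D G) S → ∣ S ∣ ≤ 2 * k
  ∣GenPos-D∣≤2gp S S-gp with Vec.splitAt n S
  ... | L , R , refl = begin
    ∣ L ++ R ∣     ≡⟨ ∣++∣ L R ⟩
    ∣ L ∣ + ∣ R ∣  ≤⟨ +-mono-≤ (proj₂ gp-G L (GenPos-++ˡ G L R S-gp))
                               (proj₂ gp-G R (GenPos-++ʳ G L R S-gp)) ⟩
    k + k          ≡⟨ k+k≡2*k k ⟩
    2 * k          ∎
    where open ≤-Reasoning

  gp-D≤2gp : k′ ≤ 2 * k
  gp-D≤2gp with proj₁ gp-DG
  ... | S , S-gp , ∣S∣≡k′ = subst (_≤ 2 * k) ∣S∣≡k′ (∣GenPos-D∣≤2gp S S-gp)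

  gp-D≡2gp⇒doubled : k′ ≡ 2 * k → ∀ S → IsGPSet (D G) S → IsDoubledGPSet G S
  gp-D≡2gp⇒doubled k′≡2k S S-gpSet@(S-gp , _) with Vec.splitAt n S
  ... | L , R , refl =
    L , GenPos-++-independent G L++L-gp , GenPos∧∣∣≡gp⇒IsGPSet gp-G L-gp ∣L∣≡k ,
    cong (L ++_) (sym L≡R)
    where
    L-gp : GenPos G L
    L-gp = GenPos-++ˡ G L R S-gp

    R-gp : GenPos G R
    R-gp = GenPos-++ʳ G L R S-gp

    ∣L∣+∣R∣≡k+k : ∣ L ∣ + ∣ R ∣ ≡ k + k
    ∣L∣+∣R∣≡k+k = begin
      ∣ L ∣ + ∣ R ∣ ≡⟨ ∣++∣ L R ⟨
      ∣ L ++ R ∣    ≡⟨ IsGPSet⇒∣∣≡gp gp-DG S-gpSet ⟩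
      k′            ≡⟨ k′≡2k ⟩
      2 * k         ≡⟨ k+k≡2*k k ⟨
      k + k         ∎
      where open ≡-Reasoning

    ∣L∣≡k : ∣ L ∣ ≡ k
    ∣L∣≡k = m≤k∧n≤k∧m+n≡k+k⇒m≡k (proj₂ gp-G L L-gp) (proj₂ gp-G R R-gp) ∣L∣+∣R∣≡k+k

    ∣R∣≡k : ∣ R ∣ ≡ k
    ∣R∣≡k = m≤k∧n≤k∧m+n≡k+k⇒m≡k (proj₂ gp-G R R-gp) (proj₂ gp-G L L-gp)
                                 (trans (+-comm ∣ R ∣ ∣ L ∣) ∣L∣+∣R∣≡k+k)

    ∣L∪R∣≤k : ∣ L ∪ R ∣ ≤ k
    ∣L∪R∣≤k = proj₂ gp-G (L ∪ R) (GenPos-∪ G L R S-gp)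

    L≡R : L ≡ R
    L≡R = ∣p∪q∣≤∣p∣∧∣p∪q∣≤∣q∣⇒p≡q L R (subst (∣ L ∪ R ∣ ≤_) (sym ∣L∣≡k) ∣L∪R∣≤k)
                                       (subst (∣ L ∪ R ∣ ≤_) (sym ∣R∣≡k) ∣L∪R∣≤k)

    L++L-gp : GenPos (D G) (L ++ L)
    L++L-gp = subst (λ R′ → GenPos (D G) (L ++ R′)) (sym L≡R) S-gp

  doubled⇒gp-D≡2gp : (∀ S → IsGPSet (D G) S → IsDoubledGPSet G S) → k′ ≡ 2 * k
  doubled⇒gp-D≡2gp doubled with gpSet gp-DG
  ... | S , S-gpSet with doubled S S-gpSet
  ...   | X , _ , X-gpSet , refl = begin
    k′            ≡⟨ IsGPSet⇒∣∣≡gp gp-DG S-gpSet ⟨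
    ∣ X ++ X ∣    ≡⟨ ∣++∣ X X ⟩
    ∣ X ∣ + ∣ X ∣ ≡⟨ cong₂ _+_ ∣X∣≡k ∣X∣≡k ⟩
    k + k         ≡⟨ k+k≡2*k k ⟩
    2 * k         ∎
    where
    open ≡-Reasoning
    ∣X∣≡k : ∣ X ∣ ≡ k
    ∣X∣≡k = IsGPSet⇒∣∣≡gp gp-G X-gpSet

GenPos-≤2 : ∀ {n} (G : Graph n) → n ≤ 2 → ∀ S → GenPos G S
GenPos-≤2 {n} G n≤2 S x y z _ _ _ x≢y y≢z x≢z _ =
  pigeonhole₂ (toℕ≡0⊎1 x) (toℕ≡0⊎1 y) (toℕ≡0⊎1 z)
              (x≢y ∘ toℕ-injective) (y≢z ∘ toℕ-injective) (x≢z ∘ toℕ-injective)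
  where
  <2⇒≡0⊎≡1 : ∀ {m} → m < 2 → m ≡ 0 ⊎ m ≡ 1
  <2⇒≡0⊎≡1 (s≤s z≤n)       = inj₁ refl
  <2⇒≡0⊎≡1 (s≤s (s≤s z≤n)) = inj₂ refl

  toℕ≡0⊎1 : (u : Fin n) → toℕ u ≡ 0 ⊎ toℕ u ≡ 1
  toℕ≡0⊎1 u = <2⇒≡0⊎≡1 (≤-trans (toℕ<n u) n≤2)

gp-≤2 : ∀ {n} (G : Graph n) → n ≤ 2 → IsGP G n
gp-≤2 {n} G n≤2 = (⊤ , GenPos-≤2 G n≤2 ⊤ , ∣⊤∣≡n n) , λ S _ → ∣p∣≤n S

complete : ∀ n → Graph n
complete n = record { adj = λ u v → not (does (u ≟ v)) ; sym = ≟-sym ; irrefl = ≟-irrefl }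
  where
  ≟-sym : ∀ u v → not (does (u ≟ v)) ≡ not (does (v ≟ u))
  ≟-sym u v with u ≟ v | v ≟ u
  ... | yes _   | yes _   = refl
  ... | no _    | no _    = refl
  ... | yes u≡v | no v≢u  = contradiction (sym u≡v) v≢u
  ... | no u≢v  | yes v≡u = contradiction (sym v≡u) u≢v

  ≟-irrefl : ∀ u → not (does (u ≟ u)) ≡ false
  ≟-irrefl u with u ≟ u
  ... | yes _   = refl
  ... | no u≢u  = contradiction refl u≢u

-- Vertices 0, 1 of D(K₂) are those of K₂ and 2, 3 their copies: any three of them contain
-- a pair of twins together with a neighbour of both.
gp-C₄≤2 : ∀ S → GenPos (D (complete 2)) S → ∣ S ∣ ≤ 2
gp-C₄≤2 (true ∷ true ∷ true ∷ _ ∷ []) S-gp =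
  ⊥-elim (GenPos⇒¬twins+neighbour (complete 2) {u = # 0} {x = # 1}
            S-gp here (there (there here)) (there here) tt)
gp-C₄≤2 (true ∷ true ∷ _ ∷ true ∷ []) S-gp =
  ⊥-elim (GenPos⇒¬twins+neighbour (complete 2) {u = # 1} {x = # 0}
            S-gp (there here) (there (there (there here))) here tt)
gp-C₄≤2 (true ∷ _ ∷ true ∷ true ∷ []) S-gp =
  ⊥-elim (GenPos⇒¬twins+neighbour (complete 2) {u = # 0} {x = # 3}
            S-gp here (there (there here)) (there (there (there here))) tt)
gp-C₄≤2 (_ ∷ true ∷ true ∷ true ∷ []) S-gp =
  ⊥-elim (GenPos⇒¬twins+neighbour (complete 2) {u = # 1} {x = # 2}
            S-gp (there here) (there (there (there here))) (there (there here)) tt)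
gp-C₄≤2 (false ∷ false ∷ S) _ = ∣p∣≤n S
gp-C₄≤2 (true ∷ false ∷ false ∷ false ∷ []) _ = ≤ᵇ⇒≤ _ _ tt
gp-C₄≤2 (true ∷ false ∷ true ∷ false ∷ []) _ = ≤ᵇ⇒≤ _ _ tt
gp-C₄≤2 (true ∷ false ∷ false ∷ true ∷ []) _ = ≤ᵇ⇒≤ _ _ tt
gp-C₄≤2 (true ∷ true ∷ false ∷ false ∷ []) _ = ≤ᵇ⇒≤ _ _ tt
gp-C₄≤2 (false ∷ true ∷ false ∷ false ∷ []) _ = ≤ᵇ⇒≤ _ _ tt
gp-C₄≤2 (false ∷ true ∷ true ∷ false ∷ []) _ = ≤ᵇ⇒≤ _ _ tt
gp-C₄≤2 (false ∷ true ∷ false ∷ true ∷ []) _ = ≤ᵇ⇒≤ _ _ tt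

gp-C₄ : IsGP (D (complete 2)) 2
gp-C₄ = (⊤ {2} ++ ∅ , GenPos-++∅ (complete 2) (GenPos-≤2 (complete 2) ≤-refl ⊤) , refl) ,
        gp-C₄≤2

theorem4p2 :
  ((n : ℕ) (G : Graph n) (k k′ : ℕ) → IsGP G k → IsGP (D G) k′ →
     (k ≤ k′ × k′ ≤ 2 * k)
     × (k′ ≡ 2 * k ⇔
         (∀ (S : Subset (n + n)) → IsGPSet (D G) S →
            Σ (Subset n) λ X → Independent G X × IsGPSet G X × S ≡ doubleSet X)))
  × (Σ ℕ λ n → 1 ≤ n × Σ (Graph n) λ G → Σ ℕ λ k → IsGP G k × IsGP (D G) k)
  × (Σ ℕ λ n → 1 ≤ n × Σ (Graph n) λ G → Σ ℕ λ k → IsGP G k × IsGP (D G) (2 * k))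
theorem4p2 =
  (λ _ _ _ _ gp-G gp-DG →
     (gp≤gp-D gp-G gp-DG , gp-D≤2gp gp-G gp-DG) ,
     mk⇔ (gp-D≡2gp⇒doubled gp-G gp-DG) (doubled⇒gp-D≡2gp gp-G gp-DG)) ,
  (2 , s≤s z≤n , complete 2 , 2 , gp-≤2 (complete 2) ≤-refl , gp-C₄) ,
  (1 , s≤s z≤n , complete 1 , 1 , gp-≤2 (complete 1) (s≤s z≤n) , gp-≤2 (D (complete 1)) ≤-refl)
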